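{- Let $p \geq 4$ be an even integer and let $D$ be an oriented graph of order $n \geq p + 2$. Then $$\mathrm{inv}^{= p}(D) \leq \frac{|A(D)|}{p-1} + 2p^2 n.$$
   Context: For an oriented graph $D$ and $X\subseteq V(D)$, the inversion of $X$ reverses the orientation of every arc with both endpoints in $X$. A $(=p)$-inversion is the inversion of a set of exactly $p$ vertices. $\mathrm{inv}^{=p}(D)$ is the minimum number of $(=p)$-inversions whose successive application makes $D$ acyclic ($+\infty$ if impossible). $A(D)$ is the arc set of $D$. -}

module Defs where

open import Data.Nat using (ℕ; zero; suc; _+_)
open import Data.Bool using (Bool; true; false; if_then_else_; _∧_)
open import Data.Fin using (Fin)
open import Data.Fin.Subset using (Subset; _∈_)
open import Data.Fin.Subset.Properties using (_∈?_)
open import Data.List using (List; map; foldl; allFin)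
open import Data.Nat.ListAction using (sum)
open import Data.Vec using (lookup)
open import Relation.Binary.PropositionalEquality using (_≡_)
open import Relation.Binary.Construct.Closure.Transitive using (TransClosure)
open import Relation.Nullary using (¬_)

record OrientedGraph (n : ℕ) : Set where
  field
    arc        : Fin n → Fin n → Bool
    loopless   : ∀ u → arc u u ≡ false
    antisym    : ∀ u v → arc u v ≡ true → arc v u ≡ false
open OrientedGraph public

Arc : ∀ {n} → OrientedGraph n → Fin n → Fin n → Set
Arc D u v = arc D u v ≡ true

arcCount : ∀ {n} → OrientedGraph n → ℕ
arcCount {n} D =
  sum (map (λ u → sum (map (λ v → if arc D u v then 1 else 0) (allFin n))) (allFin n))

Acyclic : ∀ {n} → OrientedGraph n → Set
Acyclic {n} D = ∀ (u : Fin n) → ¬ TransClosure (Arc D) u u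

invertArc : ∀ {n} → Subset n → (Fin n → Fin n → Bool) → Fin n → Fin n → Bool
invertArc X a u v = if lookup X u ∧ lookup X v then a v u else a u v

invert : ∀ {n} → Subset n → OrientedGraph n → OrientedGraph n
invert {n} X D = record
  { arc = invertArc X (arc D)
  ; loopless = ll
  ; antisym = as
  }
  where
  ll : ∀ u → invertArc X (arc D) u u ≡ false
  ll u with lookup X u
  ... | true  = loopless D u
  ... | false = loopless D u
  as : ∀ u v → invertArc X (arc D) u v ≡ true → invertArc X (arc D) v u ≡ false
  as u v h with lookup X u | lookup X v
  ... | true  | true  = antisym D v u h
  ... | true  | false = antisym D u v h
  ... | false | true  = antisym D u v h
  ... | false | false = antisym D u v h

invertAll : ∀ {n} → List (Subset n) → OrientedGraph n → OrientedGraph n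
invertAll Xs D = foldl (λ E X → invert X E) D Xs

-- Write p = s + 1 with s odd and process the vertices from the top down to vertex 2, removing the
-- arcs from the current vertex k to smaller vertices ("backward arcs"). Inverting {k} ∪ S for s
-- backward out-neighbours S of k removes s of them with one inversion, so at most s - 1 remain.
-- These are removed in pairs by a gadget of 2s inversions of size p that reverses exactly the two
-- arcs ka, kb: it works because s is odd. A last single arc costs two gadgets. Vertices above k
-- are untouched, so afterwards only arcs between vertices 0 and 1 can go down, and the graph is
-- acyclic. The cost for k is at most (#backward arcs of k)/s + O(s²); since inversions preserve
-- adjacency, the backward arcs of k are bounded by its number of smaller neighbours in D, and these
-- numbers sum to at most |A(D)|.

module Submission where

open import Defs
open import Data.Nat as ℕ using (ℕ; zero; suc; _+_; _*_; _∸_; _≤_; _<_; _≥_; z≤n; s≤s; s≤s⁻¹)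
open import Data.Nat.Properties hiding (_≟_; _<?_; <⇒≢; >⇒≢)
open import Data.Nat.Divisibility using (_∣_; divides)
open import Data.Nat.Induction using (<-wellFounded)
open import Data.Nat.Tactic.RingSolver using (solve-∀)
import Data.Nat.ListAction as List
open import Algebra.Properties.CommutativeMonoid.Sum +-0-commutativeMonoid
  using (sum; sum-syntax; sum-cong-≗; ∑-distrib-+; ∑-comm; sum-replicate-zero)
open import Data.Bool using (Bool; true; false; if_then_else_; _∧_; _∨_; not; _xor_)
open import Data.Bool.Properties
  using (∧-comm; ∧-idem; ∧-identityʳ; ∧-zeroʳ; ∨-comm; ∨-identityʳ; ∨-zeroʳ; not-involutive; not-injective;
         xor-assoc; xor-comm; xor-identityʳ; xor-same)
open import Data.Fin as Fin using (Fin; zero; suc; toℕ; fromℕ<)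
open import Data.Fin.Properties using (_≟_; _<?_; <⇒≢; toℕ-injective; toℕ-fromℕ<; toℕ<n)
open import Data.Fin.Subset using (Subset; ∣_∣)
open import Data.List using (List; []; _∷_; _++_; length; map; allFin; concat; tabulate)
open import Data.List.Properties using (length-++; foldl-++; map-tabulate)
open import Data.List.Relation.Unary.All using (All; []; _∷_)
open import Data.List.Relation.Unary.All.Properties using (++⁺; concat⁺; tabulate⁺)
open import Data.Vec as Vec using (lookup)
open import Data.Vec.Properties using (lookup∘tabulate)
open import Data.Product using (Σ; ∃; _×_; _,_)
open import Data.Sum using (inj₁; inj₂)
open import Function using (_∘_; _$_; id)
open import Induction.WellFounded using (Acc; acc)
open import Relation.Binary using (tri<; tri≈; tri>)
open import Relation.Binary.Construct.Closure.Transitive using (TransClosure; [_]; _∷_)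
open import Relation.Binary.PropositionalEquality
open import Relation.Nullary using (Dec; does; yes; no; ¬_; contradiction)
open import Relation.Nullary.Decidable using (dec-true; dec-false)

private variable
  n : ℕ
  f g : Fin n → Bool

_==_ : Fin n → Fin n → Bool
i == j = does (i ≟ j)

==-refl : (i : Fin n) → (i == i) ≡ true
==-refl i = dec-true (i ≟ i) refl

==-≢ : {i j : Fin n} → i ≢ j → (i == j) ≡ false
==-≢ {i = i} {j} = dec-false (i ≟ j)

==⇒≡ : {i j : Fin n} → (i == j) ≡ true → i ≡ j
==⇒≡ {i = i} {j} eq with i ≟ j
... | yes i≡j = i≡j

==-false⇒≢ : {i j : Fin n} → (i == j) ≡ false → i ≢ j
==-false⇒≢ {i = i} i==j refl = contradiction (trans (sym (==-refl i)) i==j) λ ()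

==-sym : (i j : Fin n) → (i == j) ≡ (j == i)
==-sym i j with i ≟ j | j ≟ i
... | yes _    | yes _    = refl
... | no _     | no _     = refl
... | yes refl | no j≢i   = contradiction refl j≢i
... | no i≢j   | yes refl = contradiction refl i≢j

>⇒≢ : {i j : Fin n} → i Fin.< j → j ≢ i
>⇒≢ = ≢-sym ∘ <⇒≢

∧≡true : ∀ x y → x ∧ y ≡ true → x ≡ true × y ≡ true
∧≡true true true refl = refl , refl

odd : ℕ → Bool
odd zero    = false
odd (suc m) = not (odd m)

odd-+-self : ∀ m → odd (m + m) ≡ false
odd-+-self zero    = refl
odd-+-self (suc m) rewrite +-suc m m = trans (not-involutive _) (odd-+-self m)

odd⇒pos : ∀ {m} → odd m ≡ true → 0 < m
odd⇒pos {suc m} _ = s≤s z≤n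

sum-mono-≤ : {f g : Fin n → ℕ} → (∀ i → f i ≤ g i) → sum f ≤ sum g
sum-mono-≤ {zero}  _   = z≤n
sum-mono-≤ {suc n} f≤g = +-mono-≤ (f≤g zero) (sum-mono-≤ (f≤g ∘ suc))

≤-sum : (f : Fin n → ℕ) (i : Fin n) → f i ≤ sum f
≤-sum f zero    = m≤m+n (f zero) _
≤-sum f (suc i) = ≤-trans (≤-sum (f ∘ suc) i) (m≤n+m _ (f zero))

χ : Bool → ℕ
χ b = if b then 1 else 0

χ-∨ : ∀ x y → χ (x ∨ y) ≤ χ x + χ y
χ-∨ true  _     = s≤s z≤n
χ-∨ false true  = ≤-refl
χ-∨ false false = z≤n

count : (Fin n → Bool) → ℕ
count f = sum (χ ∘ f)

∣tabulate∣≡count : (f : Fin n → Bool) → ∣ Vec.tabulate f ∣ ≡ count f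
∣tabulate∣≡count {zero}  f = refl
∣tabulate∣≡count {suc n} f with f zero
... | true  = cong suc (∣tabulate∣≡count (f ∘ suc))
... | false = ∣tabulate∣≡count (f ∘ suc)

count-cong : (∀ i → f i ≡ g i) → count f ≡ count g
count-cong f≗g = sum-cong-≗ (cong χ ∘ f≗g)

count-false : count {n} (λ _ → false) ≡ 0
count-false {n} = sum-replicate-zero n

count-== : (j : Fin n) → count (_== j) ≡ 1
count-== {suc n} zero    = cong suc (count-false {n})
count-== {suc n} (suc j) = count-== j

count-mono : (∀ i → f i ≡ true → g i ≡ true) → count f ≤ count g
count-mono {f = f} {g} f⊆g = sum-mono-≤ pointwise
  where
  pointwise : ∀ i → χ (f i) ≤ χ (g i)
  pointwise i with f i | f⊆g i
  ... | true  | fi⊆gi rewrite fi⊆gi refl = ≤-refl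
  ... | false | _ = z≤n

count≡0⇒false : count f ≡ 0 → ∀ i → f i ≡ false
count≡0⇒false {f = f} count≡0 i = χ≡0 (f i) (n≤0⇒n≡0 (≤-trans (≤-sum (χ ∘ f) i) (≤-reflexive count≡0)))
  where
  χ≡0 : ∀ b → χ b ≡ 0 → b ≡ false
  χ≡0 false _ = refl

count-split : (f g : Fin n → Bool) →
  count f ≡ count (λ i → f i ∧ not (g i)) + count (λ i → f i ∧ g i)
count-split f g = trans (sum-cong-≗ pointwise) (∑-distrib-+ (χ ∘ λ i → f i ∧ not (g i)) (χ ∘ λ i → f i ∧ g i))
  where
  pointwise : ∀ i → χ (f i) ≡ χ (f i ∧ not (g i)) + χ (f i ∧ g i)
  pointwise i with f i | g i
  ... | true  | true  = refl
  ... | true  | false = refl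
  ... | false | _     = refl

count-∨ : (f g : Fin n → Bool) → count (λ i → f i ∨ g i) ≤ count f + count g
count-∨ f g = ≤-trans (sum-mono-≤ (λ i → χ-∨ (f i) (g i))) (≤-reflexive (∑-distrib-+ (χ ∘ f) (χ ∘ g)))

count-not : (f : Fin n → Bool) → count (not ∘ f) + count f ≡ n
count-not {zero}  f = refl
count-not {suc n} f with f zero
... | true  = trans (+-suc _ _) (cong suc (count-not (f ∘ suc)))
... | false = cong suc (count-not (f ∘ suc))

count-remove : (j : Fin n) → f j ≡ true → count f ≡ suc (count (λ i → f i ∧ not (i == j)))
count-remove {f = f} j fj = trans (count-split f (_== j))
  (trans (cong (count (λ i → f i ∧ not (i == j)) +_) (trans (count-cong on-j) (count-== j)))
    (+-comm _ 1))
  where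
  on-j : ∀ i → (f i ∧ (i == j)) ≡ (i == j)
  on-j i with i ≟ j
  ... | yes refl rewrite fj = refl
  ... | no _ = ∧-zeroʳ (f i)

count-insert : (j : Fin n) → f j ≡ false → count (λ i → (i == j) ∨ f i) ≡ suc (count f)
count-insert {f = f} j fj = trans (count-split _ f)
  (cong₂ _+_ (trans (count-cong on-j) (count-== j)) (count-cong in-f))
  where
  on-j : ∀ i → (((i == j) ∨ f i) ∧ not (f i)) ≡ (i == j)
  on-j i with i ≟ j
  ... | yes refl rewrite fj = refl
  ... | no _ with f i
  ...   | true  = refl
  ...   | false = refl
  in-f : ∀ i → (((i == j) ∨ f i) ∧ f i) ≡ f i
  in-f i with i == j | f i
  ... | true  | true  = refl
  ... | true  | false = refl
  ... | false | b     = ∧-idem b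

witness : 1 ≤ count f → ∃ λ i → f i ≡ true
witness {suc n} {f} 1≤count with f zero in f0
... | true  = zero , f0
... | false with witness {f = f ∘ suc} 1≤count
...   | i , fi = suc i , fi

witness-other : ∀ {a} → f a ≡ true → 2 ≤ count f → ∃ λ b → f b ≡ true × a ≢ b
witness-other {f = f} {a} fa 2≤count
  with witness {f = λ x → f x ∧ not (x == a)} (s≤s⁻¹ (subst (2 ≤_) (count-remove a fa) 2≤count))
... | b , fb-b≢a with ∧≡true (f b) (not (b == a)) fb-b≢a
...   | fb , b≢a = b , fb , ≢-sym (==-false⇒≢ (not-injective b≢a))

-- choose m f keeps the first m elements of f (all of them if there are fewer).
choose : ℕ → (Fin n → Bool) → Fin n → Bool
choose zero    f i       = false
choose (suc m) f zero    = f zero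
choose (suc m) f (suc i) = choose (if f zero then m else suc m) (f ∘ suc) i

choose-⊆ : ∀ m i → choose m f i ≡ true → f i ≡ true
choose-⊆ (suc m) zero    chosen = chosen
choose-⊆ {f = f} (suc m) (suc i) chosen = choose-⊆ {f = f ∘ suc} (if f zero then m else suc m) i chosen

choose-out : ∀ m {i} → f i ≡ false → choose m f i ≡ false
choose-out {f = f} m {i} fi with choose m f i in chosen
... | false = refl
... | true  = trans (sym (choose-⊆ m i chosen)) fi

count-choose : ∀ m → m ≤ count f → count (choose m f) ≡ m
count-choose {n} zero _ = count-false {n}
count-choose {suc n} {f} (suc m) m≤count with f zero
... | true  = cong suc (count-choose {f = f ∘ suc} m (s≤s⁻¹ m≤count))
... | false = count-choose {f = f ∘ suc} (suc m) m≤count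

-- Inversions as flip patterns

both : Subset n → Fin n → Fin n → Bool
both X u v = lookup X u ∧ lookup X v

flips : List (Subset n) → Fin n → Fin n → Bool
flips []       u v = false
flips (X ∷ Xs) u v = both X u v xor flips Xs u v

arc-invertAll : (Xs : List (Subset n)) (E : OrientedGraph n) (u v : Fin n) →
  arc (invertAll Xs E) u v ≡ (if flips Xs u v then arc E v u else arc E u v)
arc-invertAll []       E u v = refl
arc-invertAll (X ∷ Xs) E u v rewrite arc-invertAll Xs (invert X E) u v
  with lookup X u | lookup X v | flips Xs u v
... | true  | true  | true  = refl
... | true  | true  | false = refl
... | true  | false | true  = refl
... | true  | false | false = refl
... | false | true  | true  = refl
... | false | true  | false = refl
... | false | false | true  = refl
... | false | false | false = refl

invertAll-++ : (Xs Ys : List (Subset n)) (E : OrientedGraph n) →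
  invertAll (Xs ++ Ys) E ≡ invertAll Ys (invertAll Xs E)
invertAll-++ Xs Ys E = foldl-++ (λ E X → invert X E) E Xs Ys

flips-sym : (Xs : List (Subset n)) (u v : Fin n) → flips Xs u v ≡ flips Xs v u
flips-sym []       u v = refl
flips-sym (X ∷ Xs) u v = cong₂ _xor_ (∧-comm (lookup X u) (lookup X v)) (flips-sym Xs u v)

flips-++ : (Xs Ys : List (Subset n)) (u v : Fin n) →
  flips (Xs ++ Ys) u v ≡ flips Xs u v xor flips Ys u v
flips-++ []       Ys u v = refl
flips-++ (X ∷ Xs) Ys u v = trans (cong (both X u v xor_) (flips-++ Xs Ys u v))
  (sym (xor-assoc (both X u v) (flips Xs u v) (flips Ys u v)))

flips-concat : ∀ {m} (g : Fin m → List (Subset n)) (u v : Fin n) →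
  flips (concat (tabulate g)) u v ≡ odd (count (λ q → flips (g q) u v))
flips-concat {m = zero}  g u v = refl
flips-concat {m = suc m} g u v
  rewrite flips-++ (g zero) (concat (tabulate (g ∘ suc))) u v | flips-concat (g ∘ suc) u v
  with flips (g zero) u v
... | true  = refl
... | false = refl

length-concat : ∀ {m} {A : Set} (g : Fin m → List A) →
  length (concat (tabulate g)) ≡ sum (length ∘ g)
length-concat {m = zero}  g = refl
length-concat {m = suc m} g = trans (length-++ (g zero)) (cong (length (g zero) +_) (length-concat (g ∘ suc)))

adjacent : OrientedGraph n → Fin n → Fin n → Bool
adjacent E u v = arc E u v ∨ arc E v u

adjacent-invertAll : (Xs : List (Subset n)) (E : OrientedGraph n) (u v : Fin n) →
  adjacent (invertAll Xs E) u v ≡ adjacent E u v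
adjacent-invertAll Xs E u v rewrite arc-invertAll Xs E u v | arc-invertAll Xs E v u | flips-sym Xs v u
  with flips Xs u v
... | true  = ∨-comm (arc E v u) (arc E u v)
... | false = refl

record Realizes (p : ℕ) (F : Fin n → Fin n → Bool) (ℓ : ℕ) : Set where
  field
    sets    : List (Subset n)
    sizes   : All (λ X → ∣ X ∣ ≡ p) sets
    flips≡  : ∀ {u v} → u ≢ v → flips sets u v ≡ F u v
    length≡ : length sets ≡ ℓ
open Realizes public

realizes-xor : ∀ {p ℓ m} {F G : Fin n → Fin n → Bool} → Realizes p F ℓ → Realizes p G m →
  Realizes p (λ u v → F u v xor G u v) (ℓ + m)
realizes-xor R S = record
  { sets    = sets R ++ sets S
  ; sizes   = ++⁺ (sizes R) (sizes S)
  ; flips≡  = λ {u} {v} u≢v → trans (flips-++ (sets R) (sets S) u v) (cong₂ _xor_ (flips≡ R u≢v) (flips≡ S u≢v))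
  ; length≡ = trans (length-++ (sets R)) (cong₂ _+_ (length≡ R) (length≡ S))
  }

arc-realized : ∀ {p ℓ} {F : Fin n → Fin n → Bool} (R : Realizes p F ℓ) (E : OrientedGraph n) {u v} → u ≢ v →
  arc (invertAll (sets R) E) u v ≡ (if F u v then arc E v u else arc E u v)
arc-realized R E {u} {v} u≢v = trans (arc-invertAll (sets R) E u v)
  (cong (λ b → if b then arc E v u else arc E u v) (flips≡ R u≢v))

single-realizes : ∀ {p} {X : Subset n} → ∣ X ∣ ≡ p → Realizes p (both X) 1
single-realizes {X = X} ∣X∣≡p = record
  { sets    = X ∷ []
  ; sizes   = ∣X∣≡p ∷ []
  ; flips≡  = λ {u} {v} _ → xor-identityʳ (both X u v)
  ; length≡ = refl
  }

-- The two-pair gadget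

star : Fin n → Fin n → Fin n → Fin n → Fin n → Bool
star c a b u v = ((u == c) ∧ ((v == a) ∨ (v == b))) ∨ ((v == c) ∧ ((u == a) ∨ (u == b)))

star-sym : (c a b u v : Fin n) → star c a b u v ≡ star c a b v u
star-sym c a b u v = ∨-comm ((u == c) ∧ ((v == a) ∨ (v == b))) ((v == c) ∧ ((u == a) ∨ (u == b)))

star-swap : (c a b u v : Fin n) → star c a b u v ≡ star c b a u v
star-swap c a b u v = cong₂ _∨_ (cong ((u == c) ∧_) (∨-comm (v == a) (v == b)))
                                (cong ((v == c) ∧_) (∨-comm (u == a) (u == b)))

star-at-arm : {c a b : Fin n} (v : Fin n) → a ≢ c → star c a b a v ≡ (v == c)
star-at-arm {c = c} {a} {b} v a≢c rewrite ==-≢ a≢c | ==-refl a = ∧-identityʳ (v == c)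

star-at-centre : {c a b j : Fin n} → j ≢ c → star c a b c j ≡ ((j == a) ∨ (j == b))
star-at-centre {c = c} {a} {b} {j} j≢c rewrite ==-refl c | ==-≢ j≢c = ∨-identityʳ ((j == a) ∨ (j == b))

star-far : {c a b v : Fin n} (j : Fin n) → v ≢ c → v ≢ a → v ≢ b → star c a b v j ≡ false
star-far {c = c} j v≢c v≢a v≢b rewrite ==-≢ v≢c | ==-≢ v≢a | ==-≢ v≢b = ∧-zeroʳ (j == c)

star-off : {c a b u v : Fin n} → u ≢ a → u ≢ b → v ≢ a → v ≢ b → star c a b u v ≡ false
star-off {c = c} {u = u} {v} u≢a u≢b v≢a v≢b
  rewrite ==-≢ u≢a | ==-≢ u≢b | ==-≢ v≢a | ==-≢ v≢b | ∧-zeroʳ (u == c) | ∧-zeroʳ (v == c) = refl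

-- With Y q = {c} ∪ Q ∖ {q}, the gadget inverts {a} ∪ Y q and {b} ∪ Y q for each q ∈ Q. A pair avoiding
-- a and b lies in both sets of a given q or in neither; ax and bx (x ∈ Q) lie in |Q| - 1 of the sets
-- and ab in none; ca and cb lie in |Q| of them. So exactly ca and cb flip when |Q| is odd.
module Gadget (Q : Fin n → Bool) (c : Fin n) where

  Y : Fin n → Fin n → Bool
  Y q x = (x == c) ∨ (Q x ∧ not (x == q))

  arm : Fin n → Fin n → Subset n
  arm a q = Vec.tabulate (λ x → (x == a) ∨ Y q x)

  arms : Fin n → Fin n → Fin n → List (Subset n)
  arms a b q = if Q q then arm a q ∷ arm b q ∷ [] else []

  gadget : Fin n → Fin n → List (Subset n)
  gadget a b = concat (tabulate (arms a b))

  contribution : Fin n → Fin n → Fin n → Fin n → Fin n → Bool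
  contribution a b u v q = Q q ∧ (both (arm a q) u v xor both (arm b q) u v)

  flips-gadget : (a b u v : Fin n) → flips (gadget a b) u v ≡ odd (count (contribution a b u v))
  flips-gadget a b u v = trans (flips-concat (arms a b) u v) (cong odd (count-cong pointwise))
    where
    pointwise : ∀ q → flips (arms a b q) u v ≡ contribution a b u v q
    pointwise q with Q q
    ... | true  = cong (both (arm a q) u v xor_) (xor-identityʳ _)
    ... | false = refl

  both-arm : (a q u v : Fin n) → both (arm a q) u v ≡ ((u == a) ∨ Y q u) ∧ ((v == a) ∨ Y q v)
  both-arm a q u v = cong₂ _∧_ (lookup∘tabulate _ u) (lookup∘tabulate _ v)

  module _ (s : ℕ) (count-Q : count Q ≡ s) (s-odd : odd s ≡ true) (Qc : Q c ≡ false) where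

    parity-Y : (v : Fin n) → odd (count (λ q → Q q ∧ Y q v)) ≡ (v == c)
    parity-Y v with v ≟ c
    ... | yes refl = trans (cong odd (trans (count-cong (λ q → ∧-identityʳ (Q q))) count-Q)) s-odd
    ... | no v≢c with Q v in Qv
    ...   | false = cong odd (trans (count-cong (λ q → ∧-zeroʳ (Q q))) (count-false {n}))
    ...   | true  = trans (cong odd (count-cong (λ q → cong (Q q ∧_) (cong not (==-sym v q)))))
                          (odd-pred (trans (sym (count-remove v Qv)) count-Q))
      where
      odd-pred : ∀ {m} → suc m ≡ s → odd m ≡ false
      odd-pred {m} refl = not-injective s-odd

    Y-outside : {a : Fin n} (q : Fin n) → a ≢ c → Q a ≡ false → Y q a ≡ false
    Y-outside q a≢c Qa rewrite ==-≢ a≢c | Qa = refl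

    flips-gadget-arm : {a : Fin n} (b v : Fin n) → a ≢ b → a ≢ c → Q a ≡ false → v ≢ a →
      flips (gadget a b) a v ≡ star c a b a v
    flips-gadget-arm {a} b v a≢b a≢c Qa v≢a = begin
      flips (gadget a b) a v                 ≡⟨ flips-gadget a b a v ⟩
      odd (count (contribution a b a v))     ≡⟨ cong odd (count-cong pointwise) ⟩
      odd (count (λ q → Q q ∧ Y q v))        ≡⟨ parity-Y v ⟩
      (v == c)                               ≡⟨ star-at-arm v a≢c ⟨
      star c a b a v                         ∎
      where
      open ≡-Reasoning
      pointwise : ∀ q → contribution a b a v q ≡ (Q q ∧ Y q v)
      pointwise q rewrite both-arm a q a v | both-arm b q a v | ==-refl a | ==-≢ a≢b | Y-outside q a≢c Qa | ==-≢ v≢a =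
        cong (Q q ∧_) (xor-identityʳ (Y q v))

    flips-gadget-swap : (a b u v : Fin n) → flips (gadget a b) u v ≡ flips (gadget b a) u v
    flips-gadget-swap a b u v = trans (flips-gadget a b u v) (trans
      (cong odd (count-cong (λ q → cong (Q q ∧_) (xor-comm (both (arm a q) u v) (both (arm b q) u v)))))
      (sym (flips-gadget b a u v)))

    flips-gadget-off : {a b u v : Fin n} → u ≢ a → u ≢ b → v ≢ a → v ≢ b → flips (gadget a b) u v ≡ false
    flips-gadget-off {a} {b} {u} {v} u≢a u≢b v≢a v≢b =
      trans (flips-gadget a b u v) (cong odd (trans (count-cong pointwise) (count-false {n})))
      where
      pointwise : ∀ q → contribution a b u v q ≡ false
      pointwise q rewrite both-arm a q u v | both-arm b q u v | ==-≢ u≢a | ==-≢ u≢b | ==-≢ v≢a | ==-≢ v≢b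
        | xor-same (Y q u ∧ Y q v) = ∧-zeroʳ (Q q)

    flips-gadget-star : {a b u v : Fin n} → a ≢ b → a ≢ c → b ≢ c → Q a ≡ false → Q b ≡ false → u ≢ v →
      flips (gadget a b) u v ≡ star c a b u v
    flips-gadget-star {a} {b} {u} {v} a≢b a≢c b≢c Qa Qb u≢v = by-cases (u ≟ a) (u ≟ b) (v ≟ a) (v ≟ b)
      where
      open ≡-Reasoning
      at-a : ∀ w → w ≢ a → flips (gadget a b) a w ≡ star c a b a w
      at-a w = flips-gadget-arm b w a≢b a≢c Qa
      at-b : ∀ w → w ≢ b → flips (gadget a b) b w ≡ star c a b b w
      at-b w w≢b = begin
        flips (gadget a b) b w  ≡⟨ flips-gadget-swap a b b w ⟩
        flips (gadget b a) b w  ≡⟨ flips-gadget-arm a w (a≢b ∘ sym) b≢c Qb w≢b ⟩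
        star c b a b w          ≡⟨ star-swap c b a b w ⟩
        star c a b b w          ∎
      swapped : ∀ {x y} → flips (gadget a b) x y ≡ star c a b x y → flips (gadget a b) y x ≡ star c a b y x
      swapped {x} {y} eq = trans (flips-sym (gadget a b) y x) (trans eq (star-sym c a b x y))
      by-cases : Dec (u ≡ a) → Dec (u ≡ b) → Dec (v ≡ a) → Dec (v ≡ b) → flips (gadget a b) u v ≡ star c a b u v
      by-cases (yes refl) _ _ _ = at-a v (u≢v ∘ sym)
      by-cases (no _) (yes refl) _ _ = at-b v (u≢v ∘ sym)
      by-cases (no _) (no _) (yes refl) _ = swapped (at-a u u≢v)
      by-cases (no _) (no _) (no _) (yes refl) = swapped (at-b u u≢v)
      by-cases (no u≢a) (no u≢b) (no v≢a) (no v≢b) =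
        trans (flips-gadget-off u≢a u≢b v≢a v≢b) (sym (star-off u≢a u≢b v≢a v≢b))

    ∣arm∣ : {a q : Fin n} → a ≢ c → Q a ≡ false → Q q ≡ true → ∣ arm a q ∣ ≡ suc s
    ∣arm∣ {a} {q} a≢c Qa Qq = begin
      ∣ arm a q ∣                                   ≡⟨ ∣tabulate∣≡count (λ x → (x == a) ∨ Y q x) ⟩
      count (λ x → (x == a) ∨ Y q x)                ≡⟨ count-insert a (Y-outside q a≢c Qa) ⟩
      suc (count (Y q))                             ≡⟨ cong suc (count-insert c (cong (_∧ not (c == q)) Qc)) ⟩
      suc (suc (count (λ x → Q x ∧ not (x == q))))  ≡⟨ cong suc (count-remove q Qq) ⟨
      suc (count Q)                                 ≡⟨ cong suc count-Q ⟩
      suc s                                         ∎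
      where open ≡-Reasoning

    gadget-realizes : {a b : Fin n} → a ≢ b → a ≢ c → b ≢ c → Q a ≡ false → Q b ≡ false →
      Realizes (suc s) (star c a b) (s + s)
    gadget-realizes {a} {b} a≢b a≢c b≢c Qa Qb = record
      { sets    = gadget a b
      ; sizes   = concat⁺ (tabulate⁺ sizes-arms)
      ; flips≡  = flips-gadget-star a≢b a≢c b≢c Qa Qb
      ; length≡ = begin
          length (gadget a b)           ≡⟨ length-concat (arms a b) ⟩
          sum (length ∘ arms a b)       ≡⟨ sum-cong-≗ length-arms ⟩
          sum (λ q → χ (Q q) + χ (Q q)) ≡⟨ ∑-distrib-+ (χ ∘ Q) (χ ∘ Q) ⟩
          count Q + count Q             ≡⟨ cong₂ _+_ count-Q count-Q ⟩
          s + s                         ∎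
      }
      where
      open ≡-Reasoning
      sizes-arms : ∀ q → All (λ X → ∣ X ∣ ≡ suc s) (arms a b q)
      sizes-arms q with Q q in Qq
      ... | true  = ∣arm∣ a≢c Qa Qq ∷ ∣arm∣ b≢c Qb Qq ∷ []
      ... | false = []
      length-arms : ∀ q → length (arms a b q) ≡ χ (Q q) + χ (Q q)
      length-arms q with Q q
      ... | true  = refl
      ... | false = refl

star-realizable : ∀ {s} → odd s ≡ true → s + 3 ≤ n → {c a b : Fin n} → a ≢ b → a ≢ c → b ≢ c →
  Realizes (suc s) (star c a b) (s + s)
star-realizable {n} {s} s-odd s+3≤n {c} {a} {b} a≢b a≢c b≢c =
  gadget-realizes s count-Q s-odd (outside c c∈near) a≢b a≢c b≢c (outside a a∈near) (outside b b∈near)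
  where
  near : Fin n → Bool
  near x = (x == a) ∨ (x == b) ∨ (x == c)
  Q : Fin n → Bool
  Q = choose s (not ∘ near)
  open Gadget Q c
  outside : ∀ x → near x ≡ true → Q x ≡ false
  outside x x∈near = choose-out s (cong not x∈near)
  a∈near : near a ≡ true
  a∈near rewrite ==-refl a = refl
  b∈near : near b ≡ true
  b∈near rewrite ==-refl b = ∨-zeroʳ (b == a)
  c∈near : near c ≡ true
  c∈near rewrite ==-refl c = trans (cong ((c == a) ∨_) (∨-zeroʳ (c == b))) (∨-zeroʳ (c == a))
  count-near : count near ≤ 3
  count-near = ≤-trans (count-∨ (_== a) (λ x → (x == b) ∨ (x == c))) (+-mono-≤ (≤-reflexive (count-== a))
    (≤-trans (count-∨ (_== b) (_== c)) (≤-reflexive (cong₂ _+_ (count-== b) (count-== c)))))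
  count-Q : count Q ≡ s
  count-Q = count-choose {f = not ∘ near} s (+-cancelʳ-≤ 3 s (count (not ∘ near)) (begin
    s + 3                              ≤⟨ s+3≤n ⟩
    n                                  ≡⟨ count-not near ⟨
    count (not ∘ near) + count near    ≤⟨ +-monoʳ-≤ (count (not ∘ near)) count-near ⟩
    count (not ∘ near) + 3             ∎))
    where open ≤-Reasoning

record Plan (p : ℕ) (E : OrientedGraph n) (P : OrientedGraph n → Set) (B : ℕ) : Set where
  field
    inversions : List (Subset n)
    sizes      : All (λ X → ∣ X ∣ ≡ p) inversions
    reaches    : P (invertAll inversions E)
    cost       : (p ∸ 1) * length inversions ≤ B
open Plan public

module _ {p : ℕ} {E : OrientedGraph n} {P : OrientedGraph n → Set} where

  stop : P E → Plan p E P 0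
  stop PE = record { inversions = [] ; sizes = [] ; reaches = PE ; cost = ≤-reflexive (*-zeroʳ (p ∸ 1)) }

  relax : ∀ {B B'} → B ≤ B' → Plan p E P B → Plan p E P B'
  relax B≤B' π = record
    { inversions = inversions π ; sizes = sizes π ; reaches = reaches π ; cost = ≤-trans (cost π) B≤B' }

  infixr 4 _▷_
  _▷_ : ∀ {B B'} {P' : OrientedGraph n → Set} (π : Plan p E P' B) →
    (P' (invertAll (inversions π) E) → Plan p (invertAll (inversions π) E) P B') → Plan p E P (B + B')
  _▷_ {B} {B'} π next = record
    { inversions = inversions π ++ inversions ρ
    ; sizes      = ++⁺ (sizes π) (sizes ρ)
    ; reaches    = subst P (sym (invertAll-++ (inversions π) (inversions ρ) E)) (reaches ρ)
    ; cost       = begin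
        (p ∸ 1) * length (inversions π ++ inversions ρ)                   ≡⟨ cong ((p ∸ 1) *_) (length-++ (inversions π)) ⟩
        (p ∸ 1) * (length (inversions π) + length (inversions ρ))         ≡⟨ *-distribˡ-+ (p ∸ 1) (length (inversions π)) _ ⟩
        (p ∸ 1) * length (inversions π) + (p ∸ 1) * length (inversions ρ) ≤⟨ +-mono-≤ (cost π) (cost ρ) ⟩
        B + B'                                                              ∎
    }
    where
    open ≤-Reasoning
    ρ : Plan p (invertAll (inversions π) E) P B'
    ρ = next (reaches π)

remap : ∀ {p B} {E : OrientedGraph n} {P Q : OrientedGraph n → Set} → (∀ {E'} → P E' → Q E') →
  Plan p E P B → Plan p E Q B
remap P⇒Q π = record
  { inversions = inversions π ; sizes = sizes π ; reaches = P⇒Q (reaches π) ; cost = cost π }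

backOut : OrientedGraph n → Fin n → Fin n → Bool
backOut E k j = does (j <? k) ∧ arc E k j

Settled : OrientedGraph n → ℕ → Set
Settled E m = ∀ {v j} → m ≤ toℕ v → j Fin.< v → arc E v j ≡ false

record FlipsRow (k : Fin n) (F : Fin n → Fin n → Bool) (T : Fin n → Bool) : Set where
  field
    on-row : ∀ {j} → j Fin.< k → F k j ≡ T j
    above  : ∀ {v} j → k Fin.< v → F v j ≡ false
open FlipsRow public

module _ {E : OrientedGraph n} {k j : Fin n} where

  backOut-below : j Fin.< k → backOut E k j ≡ arc E k j
  backOut-below j<k = cong (_∧ arc E k j) (dec-true (j <? k) j<k)

  backOut-not-below : ¬ j Fin.< k → backOut E k j ≡ false
  backOut-not-below j≮k = cong (_∧ arc E k j) (dec-false (j <? k) j≮k)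

  backOut⇒< : backOut E k j ≡ true → j Fin.< k
  backOut⇒< out with j <? k
  ... | yes j<k = j<k
  ... | no j≮k  = contradiction (trans (sym (backOut-not-below j≮k)) out) λ ()

  backOut⇒arc : backOut E k j ≡ true → arc E k j ≡ true
  backOut⇒arc out = trans (sym (backOut-below (backOut⇒< out))) out

record Pending (k : Fin n) (r : ℕ) (E : OrientedGraph n) : Set where
  constructor pending
  field
    settled   : Settled E (suc (toℕ k))
    remaining : count (backOut E k) ≡ r

settle : ∀ {k : Fin n} {E} → Pending k 0 E → Settled E (toℕ k)
settle {k = k} {E} (pending settled none) {v} {j} k≤v j<v with m≤n⇒m<n∨m≡n k≤v
... | inj₁ k<v = settled k<v j<v
... | inj₂ k≡v with toℕ-injective k≡v
...   | refl = trans (sym (backOut-below {E = E} j<v)) (count≡0⇒false none j)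

module _ {p ℓ : ℕ} {F : Fin n → Fin n → Bool} {T : Fin n → Bool} {k : Fin n} {E : OrientedGraph n}
         (R : Realizes p F ℓ) (row : FlipsRow k F T) where

  private
    E' : OrientedGraph n
    E' = invertAll (sets R) E

  settled-after : Settled E (suc (toℕ k)) → Settled E' (suc (toℕ k))
  settled-after settled {v} {j} k<v j<v
    rewrite arc-realized R E (>⇒≢ j<v) | above row j k<v = settled k<v j<v

  backOut-after : (∀ j → T j ≡ true → backOut E k j ≡ true) → ∀ j → backOut E' k j ≡ (backOut E k j ∧ not (T j))
  backOut-after T⊆ j with j <? k
  ... | no j≮k  rewrite backOut-not-below {E = E'} j≮k | backOut-not-below {E = E} j≮k = refl
  ... | yes j<k rewrite backOut-below {E = E'} j<k | backOut-below {E = E} j<k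
                      | arc-realized R E (>⇒≢ j<k) | on-row row j<k with T j in Tj
  ...   | true  = trans (antisym E k j (backOut⇒arc {E = E} {k} {j} (T⊆ j Tj))) (sym (∧-zeroʳ (arc E k j)))
  ...   | false = sym (∧-identityʳ (arc E k j))

  eliminate : ∀ {t r} → (∀ j → T j ≡ true → backOut E k j ≡ true) → count T ≡ t →
    Pending k (t + r) E → Plan p E (Pending k r) ((p ∸ 1) * ℓ)
  eliminate {t} {r} T⊆ count-T (pending settled count≡) = record
    { inversions = sets R
    ; sizes      = sizes R
    ; reaches    = pending (settled-after settled) (+-cancelʳ-≡ t _ r counts)
    ; cost       = ≤-reflexive (cong ((p ∸ 1) *_) (length≡ R))
    }
    where
    open ≡-Reasoning
    T-inside : ∀ j → (backOut E k j ∧ T j) ≡ T j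
    T-inside j with T j in Tj
    ... | true  = trans (∧-identityʳ _) (T⊆ j Tj)
    ... | false = ∧-zeroʳ _
    counts : count (backOut E' k) + t ≡ r + t
    counts = begin
      count (backOut E' k) + t                                                     ≡⟨ cong (count (backOut E' k) +_) count-T ⟨
      count (backOut E' k) + count T                                               ≡⟨ cong₂ _+_ (count-cong (backOut-after T⊆)) (sym (count-cong T-inside)) ⟩
      count (λ j → backOut E k j ∧ not (T j)) + count (λ j → backOut E k j ∧ T j) ≡⟨ count-split (backOut E k) T ⟨
      count (backOut E k)                                                          ≡⟨ count≡ ⟩
      t + r                                                                        ≡⟨ +-comm t r ⟩
      r + t                                                                        ∎

module Clearing {n s : ℕ} (s-odd : odd s ≡ true) (s+3≤n : s + 3 ≤ n) where

  drop-chunk : ∀ {k r E} → Pending k (s + r) E → Plan (suc s) E (Pending k r) (s * 1)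
  drop-chunk {k} {r} {E} pend@(pending _ count≡) =
    eliminate (single-realizes {X = X} ∣X∣≡) row (λ j → choose-⊆ {f = backOut E k} s j) count-T pend
    where
    T : Fin n → Bool
    T = choose s (backOut E k)
    count-T : count T ≡ s
    count-T = count-choose {f = backOut E k} s (subst (s ≤_) (sym count≡) (m≤m+n s r))
    T-out : ∀ {j} → ¬ j Fin.< k → T j ≡ false
    T-out j≮k = choose-out {f = backOut E k} s (backOut-not-below {E = E} j≮k)
    X : Subset n
    X = Vec.tabulate (λ x → (x == k) ∨ T x)
    ∣X∣≡ : ∣ X ∣ ≡ suc s
    ∣X∣≡ = trans (∣tabulate∣≡count (λ x → (x == k) ∨ T x))
                 (trans (count-insert {f = T} k (T-out (<-irrefl refl))) (cong suc count-T))
    both-X : ∀ j → both X k j ≡ ((j == k) ∨ T j)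
    both-X j rewrite lookup∘tabulate (λ x → (x == k) ∨ T x) k | ==-refl k = lookup∘tabulate _ j
    row : FlipsRow k (both X) T
    row = record
      { on-row = λ {j} j<k → trans (both-X j) (cong (_∨ T j) (==-≢ (<⇒≢ j<k)))
      ; above  = λ {v} j k<v → trans (cong (_∧ lookup X j) (lookup∘tabulate _ v))
                   (cong₂ (λ x y → (x ∨ y) ∧ lookup X j) (==-≢ (>⇒≢ k<v)) (T-out (<-asym k<v)))
      }

  drop-pair : ∀ {k r E} {a b : Fin n} → backOut E k a ≡ true → backOut E k b ≡ true → a ≢ b →
    Pending k (2 + r) E → Plan (suc s) E (Pending k r) (s * (s + s))
  drop-pair {k} {r} {E} {a} {b} a-out b-out a≢b =
    eliminate (star-realizable s-odd s+3≤n a≢b (<⇒≢ a<k) (<⇒≢ b<k)) row T⊆ count-T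
    where
    a<k : a Fin.< k
    a<k = backOut⇒< {E = E} a-out
    b<k : b Fin.< k
    b<k = backOut⇒< {E = E} b-out
    T : Fin n → Bool
    T j = (j == a) ∨ (j == b)
    count-T : count T ≡ 2
    count-T = trans (count-insert {f = _== b} a (==-≢ a≢b)) (cong suc (count-== b))
    T⊆ : ∀ j → T j ≡ true → backOut E k j ≡ true
    T⊆ j Tj with j ≟ a
    ... | yes refl = a-out
    ... | no _     = subst (λ x → backOut E k x ≡ true) (sym (==⇒≡ Tj)) b-out
    row : FlipsRow k (star k a b) T
    row = record
      { on-row = λ j<k → star-at-centre (<⇒≢ j<k)
      ; above  = λ j k<v → star-far j (>⇒≢ k<v) (>⇒≢ (<-trans a<k k<v)) (>⇒≢ (<-trans b<k k<v))
      }

  -- A lone backward arc ka is flipped together with kz; a second gadget flips kz back, at the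
  -- price of also flipping zz', which is harmless because z and z' are among the two lowest vertices.
  drop-single : ∀ {k E} {a z z' : Fin n} → backOut E k a ≡ true → z Fin.< k → z' Fin.< k → a ≢ z → z' ≢ z →
    Pending k 1 E → Plan (suc s) E (Pending k 0) (s * ((s + s) + (s + s)))
  drop-single {k} {E} {a} {z} {z'} a-out z<k z'<k a≢z z'≢z =
    eliminate (realizes-xor (star-realizable s-odd s+3≤n a≢z (<⇒≢ a<k) (<⇒≢ z<k))
                            (star-realizable s-odd s+3≤n (>⇒≢ z'<k) (>⇒≢ z<k) z'≢z))
      row (λ j j==a → subst (λ x → backOut E k x ≡ true) (sym (==⇒≡ j==a)) a-out) (count-== a)
    where
    a<k : a Fin.< k
    a<k = backOut⇒< {E = E} a-out
    cancel-z : ∀ j → ((j == a) ∨ (j == z)) xor (j == z) ≡ (j == a)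
    cancel-z j with j ≟ a
    ... | yes refl rewrite ==-≢ a≢z = refl
    ... | no _ = xor-same (j == z)
    row : FlipsRow k (λ u v → star k a z u v xor star z k z' u v) (_== a)
    row = record
      { on-row = λ {j} j<k → trans (cong₂ _xor_ (star-at-centre (<⇒≢ j<k)) (star-at-arm j (>⇒≢ z<k)))
                                   (cancel-z j)
      ; above  = λ j k<v → cong₂ _xor_
          (star-far j (>⇒≢ k<v) (>⇒≢ (<-trans a<k k<v)) (>⇒≢ (<-trans z<k k<v)))
          (star-far j (>⇒≢ (<-trans z<k k<v)) (>⇒≢ k<v) (>⇒≢ (<-trans z'<k k<v)))
      }

  C : ℕ
  C = s * s * (s + 2)

  module _ {k z₀ z₁ : Fin n} (z₀<k : z₀ Fin.< k) (z₁<k : z₁ Fin.< k) (z₀≢z₁ : z₀ ≢ z₁) where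

    clear-few : ∀ {E} r → Pending k r E → Plan (suc s) E (λ E' → Settled E' (toℕ k)) (s * s * (r + 3))
    clear-few zero pend = relax z≤n (stop (settle pend))
    clear-few {E} (suc zero) pend@(pending _ count≡)
      with witness {f = backOut E k} (subst (1 ≤_) (sym count≡) ≤-refl)
    ... | a , a-out = relax (≤-reflexive (single-cost s)) (drop-a ▷ stop ∘ settle)
      where
      single-cost : ∀ s → s * ((s + s) + (s + s)) + 0 ≡ s * s * (1 + 3)
      single-cost = solve-∀
      drop-a : Plan (suc s) E (Pending k 0) (s * ((s + s) + (s + s)))
      drop-a with a ≟ z₀
      ... | yes refl = drop-single a-out z₁<k z₀<k z₀≢z₁ z₀≢z₁ pend
      ... | no a≢z₀  = drop-single a-out z₀<k z₁<k a≢z₀ (≢-sym z₀≢z₁) pend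
    clear-few {E} (suc (suc r)) pend@(pending _ count≡)
      with witness {f = backOut E k} (subst (1 ≤_) (sym count≡) (s≤s z≤n))
    ... | a , a-out with witness-other a-out (subst (2 ≤_) (sym count≡) (s≤s (s≤s z≤n)))
    ...   | b , b-out , a≢b = relax (≤-reflexive (pair-cost s r)) (drop-pair a-out b-out a≢b pend ▷ clear-few r)
      where
      pair-cost : ∀ s r → s * (s + s) + s * s * (r + 3) ≡ s * s * (2 + r + 3)
      pair-cost = solve-∀

    clear-vertex : ∀ {E} r → Acc _<_ r → Pending k r E → Plan (suc s) E (λ E' → Settled E' (toℕ k)) (r + C)
    clear-vertex {E} r (acc smaller) pend with s ≤? r
    ... | yes s≤r = relax (≤-reflexive chunk-cost)
      (drop-chunk (subst (λ m → Pending k m E) (sym (m+[n∸m]≡n s≤r)) pend)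
        ▷ clear-vertex (r ∸ s) (smaller (∸-monoʳ-< (odd⇒pos s-odd) s≤r)))
      where
      chunk-cost : s * 1 + (r ∸ s + C) ≡ r + C
      chunk-cost rewrite *-identityʳ s | sym (+-assoc s (r ∸ s) C) | m+[n∸m]≡n s≤r = refl
    ... | no s≰r  = relax few-cost (clear-few r pend)
      where
      few-cost : s * s * (r + 3) ≤ r + C
      few-cost = ≤-trans (*-monoʳ-≤ (s * s) (≤-trans (≤-reflexive (+-suc r 2)) (+-monoˡ-≤ 2 (≰⇒> s≰r))))
                         (m≤n+m C r)

-- Degree accounting

sum-tabulate : ∀ {m} (f : Fin m → ℕ) → List.sum (tabulate f) ≡ sum f
sum-tabulate {zero}  f = refl
sum-tabulate {suc m} f = cong (f zero +_) (sum-tabulate (f ∘ suc))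

list-sum-allFin : (f : Fin n → ℕ) → List.sum (map f (allFin n)) ≡ sum f
list-sum-allFin f = trans (cong List.sum (map-tabulate id f)) (sum-tabulate f)

arcCount≡ : (D : OrientedGraph n) → arcCount D ≡ sum (λ u → count (arc D u))
arcCount≡ {n} D = trans (list-sum-allFin (λ u → List.sum (map (χ ∘ arc D u) (allFin n))))
  (sum-cong-≗ (λ u → list-sum-allFin (χ ∘ arc D u)))

lowerDegree : OrientedGraph n → Fin n → ℕ
lowerDegree D k = count (λ j → does (j <? k) ∧ adjacent D k j)

module _ (D : OrientedGraph n) where

  backOut≤lowerDegree : {E : OrientedGraph n} → (∀ u v → adjacent E u v ≡ adjacent D u v) →
    (k : Fin n) → count (backOut E k) ≤ lowerDegree D k
  backOut≤lowerDegree {E} same k = count-mono out⇒adjacent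
    where
    out⇒adjacent : ∀ j → backOut E k j ≡ true → (does (j <? k) ∧ adjacent D k j) ≡ true
    out⇒adjacent j out with ∧≡true (does (j <? k)) (arc E k j) out
    ... | below , arc-kj = cong₂ _∧_ below (trans (sym (same k j)) (cong (_∨ arc E j k) arc-kj))

  ∑lowerDegree≤arcCount : sum (lowerDegree D) ≤ arcCount D
  ∑lowerDegree≤arcCount = begin
    sum (lowerDegree D)                                           ≤⟨ sum-mono-≤ (λ k → sum-mono-≤ (split k)) ⟩
    ∑[ k < n ] ∑[ j < n ] (down k j + up j k)                     ≡⟨ sum-cong-≗ (λ k → ∑-distrib-+ (down k) (λ j → up j k)) ⟩
    ∑[ k < n ] (∑[ j < n ] down k j + ∑[ j < n ] up j k)          ≡⟨ ∑-distrib-+ (λ k → sum (down k)) (λ k → ∑[ j < n ] up j k) ⟩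
    ∑[ u < n ] sum (down u) + ∑[ k < n ] ∑[ j < n ] up j k        ≡⟨ cong (∑[ u < n ] sum (down u) +_) (∑-comm (λ k j → up j k)) ⟩
    ∑[ u < n ] sum (down u) + ∑[ u < n ] sum (up u)               ≡⟨ ∑-distrib-+ (λ u → sum (down u)) (λ u → sum (up u)) ⟨
    ∑[ u < n ] (sum (down u) + sum (up u))                        ≡⟨ sum-cong-≗ (λ u → ∑-distrib-+ (down u) (up u)) ⟨
    ∑[ u < n ] ∑[ v < n ] (down u v + up u v)                     ≤⟨ sum-mono-≤ (λ u → sum-mono-≤ (down+up≤arc u)) ⟩
    ∑[ u < n ] count (arc D u)                                    ≡⟨ arcCount≡ D ⟨
    arcCount D                                                    ∎
    where
    open ≤-Reasoning
    down up : Fin n → Fin n → ℕ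
    down u v = χ (does (v <? u) ∧ arc D u v)
    up   u v = χ (does (u <? v) ∧ arc D u v)
    split : ∀ k j → χ (does (j <? k) ∧ adjacent D k j) ≤ down k j + up j k
    split k j with does (j <? k)
    ... | true  = χ-∨ (arc D k j) (arc D j k)
    ... | false = z≤n
    down+up≤arc : ∀ u v → down u v + up u v ≤ χ (arc D u v)
    down+up≤arc u v = exclusive (v <? u) (u <? v) (arc D u v)
      where
      exclusive : (v<u? : Dec (v Fin.< u)) (u<v? : Dec (u Fin.< v)) (a : Bool) →
        χ (does v<u? ∧ a) + χ (does u<v? ∧ a) ≤ χ a
      exclusive (yes v<u) (yes u<v) _     = contradiction v<u (<-asym u<v)
      exclusive (yes _)   (no _)    true  = ≤-refl
      exclusive (no _)    (yes _)   true  = ≤-refl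
      exclusive (no _)    (no _)    true  = z≤n
      exclusive v<u?      u<v?      false = ≤-reflexive
        (cong₂ _+_ (cong χ (∧-zeroʳ (does v<u?))) (cong χ (∧-zeroʳ (does u<v?))))

  degreeBelow : ℕ → ℕ
  degreeBelow m = sum (λ v → if does (toℕ v ℕ.<? m) then lowerDegree D v else 0)

  degreeBelow≤ : ∀ m → degreeBelow m ≤ sum (lowerDegree D)
  degreeBelow≤ m = sum-mono-≤ (λ v → guarded (does (toℕ v ℕ.<? m)) (lowerDegree D v))
    where
    guarded : ∀ b x → (if b then x else 0) ≤ x
    guarded true  x = ≤-refl
    guarded false x = z≤n

  degreeBelow-step : (k : Fin n) → degreeBelow (toℕ k) + lowerDegree D k ≤ degreeBelow (suc (toℕ k))
  degreeBelow-step k = begin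
    degreeBelow (toℕ k) + lowerDegree D k                   ≤⟨ +-monoʳ-≤ (degreeBelow (toℕ k)) at-k ⟩
    degreeBelow (toℕ k) + sum only-k                        ≡⟨ ∑-distrib-+ below-k only-k ⟨
    ∑[ v < n ] (below-k v + only-k v)                       ≤⟨ sum-mono-≤ (λ v → extend (toℕ v ℕ.<? toℕ k) (v ≟ k) (toℕ v ℕ.<? suc (toℕ k))) ⟩
    degreeBelow (suc (toℕ k))                               ∎
    where
    open ≤-Reasoning
    below-k only-k : Fin n → ℕ
    below-k v = if does (toℕ v ℕ.<? toℕ k) then lowerDegree D v else 0
    only-k  v = if v == k then lowerDegree D v else 0
    at-k : lowerDegree D k ≤ sum only-k
    at-k = ≤-trans (≤-reflexive (cong (λ b → if b then lowerDegree D k else 0) (sym (==-refl k)))) (≤-sum only-k k)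
    extend : ∀ {v} (v<k? : Dec (toℕ v ℕ.< toℕ k)) (v≡k? : Dec (v ≡ k)) (v≤k? : Dec (toℕ v ℕ.< suc (toℕ k))) →
      (if does v<k? then lowerDegree D v else 0) + (if does v≡k? then lowerDegree D v else 0)
        ≤ (if does v≤k? then lowerDegree D v else 0)
    extend (yes v<k) (yes refl) _          = contradiction v<k (<-irrefl refl)
    extend (yes _)   (no _)     (yes _)    = ≤-reflexive (+-identityʳ _)
    extend (yes v<k) _          (no v≮1+k) = contradiction (m<n⇒m<1+n v<k) v≮1+k
    extend (no _)    (yes _)    (yes _)    = ≤-refl
    extend (no _)    (yes refl) (no v≮1+v) = contradiction (n<1+n _) v≮1+v
    extend (no _)    (no _)     _          = z≤n

acyclic-of-rank : (E : OrientedGraph n) (rank : Fin n → ℕ) → (∀ {u v} → Arc E u v → rank u ℕ.< rank v) → Acyclic E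
acyclic-of-rank E rank increasing u cycle = <-irrefl refl (along cycle)
  where
  along : ∀ {u v} → TransClosure (Arc E) u v → rank u ℕ.< rank v
  along [ u→v ]       = increasing u→v
  along (u→w ∷ w→⁺v) = <-trans (increasing u→w) (along w→⁺v)

settled⇒acyclic : (E : OrientedGraph (suc (suc n))) → Settled E 2 → Acyclic E
settled⇒acyclic E settled = acyclic-of-rank E rank increasing
  where
  1→0 : Bool
  1→0 = arc E (suc zero) zero
  rank : Fin (suc (suc n)) → ℕ
  rank zero          = χ 1→0
  rank (suc zero)    = χ (not 1→0)
  rank (suc (suc v)) = suc (suc (toℕ v))
  χ≤1 : ∀ b → χ b ℕ.< 2
  χ≤1 true  = s≤s (s≤s z≤n)
  χ≤1 false = s≤s z≤n
  backward : ∀ {u v} → 2 ≤ toℕ u → v Fin.< u → ¬ Arc E u v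
  backward 2≤u v<u u→v = contradiction (trans (sym u→v) (settled 2≤u v<u)) λ ()
  increasing : ∀ {u v} → Arc E u v → rank u ℕ.< rank v
  increasing {zero}          {zero}          u→v = contradiction (trans (sym u→v) (loopless E zero)) λ ()
  increasing {zero}          {suc zero}      u→v rewrite antisym E zero (suc zero) u→v = s≤s z≤n
  increasing {suc zero}      {zero}          u→v rewrite u→v = s≤s z≤n
  increasing {suc zero}      {suc zero}      u→v = contradiction (trans (sym u→v) (loopless E (suc zero))) λ ()
  increasing {zero}          {suc (suc v)}   _   = ≤-trans (χ≤1 1→0) (s≤s (s≤s z≤n))
  increasing {suc zero}      {suc (suc v)}   _   = ≤-trans (χ≤1 (not 1→0)) (s≤s (s≤s z≤n))
  increasing {suc (suc u)}   {zero}          u→v = contradiction u→v (backward (s≤s (s≤s z≤n)) (s≤s z≤n))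
  increasing {suc (suc u)}   {suc zero}      u→v = contradiction u→v (backward (s≤s (s≤s z≤n)) (s≤s (s≤s z≤n)))
  increasing {suc (suc u)}   {suc (suc v)}   u→v with <-cmp (toℕ u) (toℕ v)
  ... | tri< u<v _ _ = s≤s (s≤s u<v)
  ... | tri≈ _ u≡v _ rewrite toℕ-injective u≡v = contradiction (trans (sym u→v) (loopless E _)) λ ()
  ... | tri> _ _ v<u = contradiction u→v (backward (s≤s (s≤s z≤n)) (s≤s (s≤s v<u)))

module Settling {n s : ℕ} (s-odd : odd s ≡ true) (s+3≤n : s + 3 ≤ suc (suc n)) (D : OrientedGraph (suc (suc n))) where
  open Clearing s-odd s+3≤n

  SameAdjacency : OrientedGraph (suc (suc n)) → Set
  SameAdjacency E = ∀ u v → adjacent E u v ≡ adjacent D u v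

  settle-from : ∀ t → 2 + t ≤ suc (suc n) → ∀ {E} → SameAdjacency E → Settled E (2 + t) →
    Plan (suc s) E (λ E' → Settled E' 2) (degreeBelow D (2 + t) + t * C)
  settle-from zero    _    _    settled = relax z≤n (stop settled)
  settle-from (suc t) 3+t≤ {E} same settled = relax budget (cleared ▷ λ done →
    settle-from t (<⇒≤ 3+t≤) same' (subst (Settled (invertAll (inversions cleared) E)) k≡ done))
    where
    k : Fin (suc (suc n))
    k = fromℕ< 3+t≤
    k≡ : toℕ k ≡ 2 + t
    k≡ = toℕ-fromℕ< 3+t≤
    cleared : Plan (suc s) E (λ E' → Settled E' (toℕ k)) (count (backOut E k) + C)
    cleared = clear-vertex {z₀ = zero} {z₁ = suc zero} (subst (0 ℕ.<_) (sym k≡) (s≤s z≤n))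
      (subst (1 ℕ.<_) (sym k≡) (s≤s (s≤s z≤n))) (λ ()) (count (backOut E k)) (<-wellFounded _)
      (pending (subst (λ m → Settled E (suc m)) (sym k≡) settled) refl)
    same' : SameAdjacency (invertAll (inversions cleared) E)
    same' u v = trans (adjacent-invertAll (inversions cleared) E u v) (same u v)
    budget : count (backOut E k) + C + (degreeBelow D (2 + t) + t * C) ≤ degreeBelow D (3 + t) + suc t * C
    budget = begin
      count (backOut E k) + C + (degreeBelow D (2 + t) + t * C)  ≤⟨ +-monoˡ-≤ _ (+-monoˡ-≤ C (backOut≤lowerDegree D {E = E} same k)) ⟩
      lowerDegree D k + C + (degreeBelow D (2 + t) + t * C)      ≡⟨ regroup (lowerDegree D k) C (degreeBelow D (2 + t)) (t * C) ⟩
      degreeBelow D (2 + t) + lowerDegree D k + suc t * C        ≤⟨ +-monoˡ-≤ (suc t * C) next-vertex ⟩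
      degreeBelow D (3 + t) + suc t * C                          ∎
      where
      open ≤-Reasoning
      regroup : ∀ d c Δ tc → d + c + (Δ + tc) ≡ Δ + d + (c + tc)
      regroup = solve-∀
      next-vertex : degreeBelow D (2 + t) + lowerDegree D k ≤ degreeBelow D (3 + t)
      next-vertex = subst (λ m → degreeBelow D m + lowerDegree D k ≤ degreeBelow D (suc m)) k≡ (degreeBelow-step D k)

  settle-all : Plan (suc s) D Acyclic (degreeBelow D (suc (suc n)) + n * C)
  settle-all = remap (λ {E} → settled⇒acyclic E) (settle-from n ≤-refl (λ _ _ → refl) nothing-above)
    where
    nothing-above : Settled D (suc (suc n))
    nothing-above {v} n≤v _ = contradiction (toℕ<n v) (≤⇒≯ n≤v)

2∣suc⇒odd : ∀ {s} → 2 ∣ suc s → odd s ≡ true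
2∣suc⇒odd {s} (divides q 1+s≡q*2) = not-injective (begin
  odd (suc s)        ≡⟨ cong odd 1+s≡q*2 ⟩
  odd (q * 2)        ≡⟨ cong odd (*-comm q 2) ⟩
  odd (q + (q + 0))  ≡⟨ cong (λ m → odd (q + m)) (+-identityʳ q) ⟩
  odd (q + q)        ≡⟨ odd-+-self q ⟩
  false              ∎)
  where open ≡-Reasoning

overhead≤ : ∀ s n → n * (s * s * (s + 2)) ≤ 2 * (suc s * suc s) * suc (suc n) * s
overhead≤ s n = begin
  n * (s * s * (s + 2))                      ≤⟨ *-monoˡ-≤ _ (≤-trans (n≤1+n n) (n≤1+n (suc n))) ⟩
  suc (suc n) * (s * s * (s + 2))            ≡⟨ regroup s (suc (suc n)) ⟩
  suc (suc n) * s * (s * (s + 2))            ≤⟨ *-monoʳ-≤ (suc (suc n) * s) (≤-trans (m≤m+n _ _) (≤-reflexive (square s))) ⟩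
  suc (suc n) * s * (2 * (suc s * suc s))    ≡⟨ regroup′ s (suc (suc n)) ⟩
  2 * (suc s * suc s) * suc (suc n) * s      ∎
  where
  open ≤-Reasoning
  regroup : ∀ s m → m * (s * s * (s + 2)) ≡ m * s * (s * (s + 2))
  regroup = solve-∀
  square : ∀ s → s * (s + 2) + (s * s + 2 * s + 2) ≡ 2 * (suc s * suc s)
  square = solve-∀
  regroup′ : ∀ s m → m * s * (2 * (suc s * suc s)) ≡ 2 * (suc s * suc s) * m * s
  regroup′ = solve-∀

theorem1p10 : (p : ℕ) → p ≥ 4 → 2 ∣ p → (n : ℕ) → n ≥ p + 2 → (D : OrientedGraph n) →
    Σ (List (Subset n)) λ Xs →
      All (λ X → ∣ X ∣ ≡ p) Xs × Acyclic (invertAll Xs D) ×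
      (p ∸ 1) * length Xs ≤ arcCount D + 2 * (p * p) * n * (p ∸ 1)
theorem1p10 zero    () _ _ _ _
theorem1p10 (suc s) _  _ zero () _
theorem1p10 (suc s) _  _ (suc zero) (s≤s s+2≤0) _ = contradiction (≤-trans (m≤n+m 2 s) s+2≤0) λ ()
theorem1p10 (suc s) _  2∣p (suc (suc n)) p+2≤n D =
  inversions π , sizes π , reaches π , cost π
  where
  open Settling (2∣suc⇒odd 2∣p) (≤-trans (≤-reflexive (+-suc s 2)) p+2≤n) D
  π : Plan (suc s) D Acyclic (arcCount D + 2 * (suc s * suc s) * suc (suc n) * s)
  π = relax (+-mono-≤ (≤-trans (degreeBelow≤ D (suc (suc n))) (∑lowerDegree≤arcCount D)) (overhead≤ s n)) settle-all
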